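{- For every graph $G$ with neighbourhood diversity $t$, $\chi_{ssc}(G)\le t$.
   Context: Graphs are finite, simple and undirected. For a vertex $v$, $N(v)$ is its open neighbourhood, $N[v]=N(v)\cup\{v\}$ and $\deg(v)=|N(v)|$. For a positive integer $q$, a $q$-subset square colouring of a graph $G$ is a function $c:V(G)\to\{c_0,c_1,\dots,c_q\}$ such that (i) for every vertex $v$ and every $i\in\{1,\dots,q\}$, $|c^{ -1}(c_i)\cap N[v]|\le 1$, and (ii) for every vertex $v$, $N[v]$ contains at most $\deg(v)$ vertices of colour $c_0$ (equivalently, $N[v]$ contains at least one vertex whose colour lies in $\{c_1,\dots,c_q\}$). $\chi_{ssc}(G)$ is the minimum $q$ such that $G$ admits a $q$-subset square colouring. Two vertices $u,v$ have the same type if $N(v)\setminus\{u\}=N(u)\setminus\{v\}$. $G$ has neighbourhood diversity $t$ if $t$ is the minimum number of sets in a partition of $V(G)$ such that all vertices in each set have the same type. -}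

module Defs where

open import Data.Nat using (ℕ; zero; suc; _+_; _≤_)
open import Data.Fin using (Fin; zero; suc; _≟_)
open import Data.Bool using (Bool; true; false; _∨_; _∧_; if_then_else_)
open import Data.Maybe using (Maybe; just; nothing; is-nothing)
open import Data.Product using (Σ; _×_; ∃-syntax)
open import Relation.Nullary using (¬_)
open import Relation.Nullary.Decidable using (⌊_⌋)
open import Relation.Binary.PropositionalEquality using (_≡_; _≢_)

record Graph : Set where
  field
    n      : ℕ
    adj    : Fin n → Fin n → Bool
    sym    : ∀ u v → adj u v ≡ adj v u
    irrefl : ∀ v → adj v v ≡ false
open Graph public

count : ∀ {m} → (Fin m → Bool) → ℕ
count {zero}  P = 0
count {suc m} P = (if P zero then 1 else 0) + count {m} (λ i → P (suc i))

module _ (G : Graph) where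
  V : Set
  V = Fin (n G)

  inN : V → V → Bool
  inN v u = adj G v u

  inN[] : V → V → Bool
  inN[] v u = ⌊ u ≟ v ⌋ ∨ adj G v u

  deg : V → ℕ
  deg v = count (inN v)

  SameType : V → V → Set
  SameType u v = ∀ w → (w ≢ u × inN v w ≡ true → w ≢ v × inN u w ≡ true)
                     × (w ≢ v × inN u w ≡ true → w ≢ u × inN v w ≡ true)

  TypePartition : ℕ → Set
  TypePartition t = Σ (V → Fin t) λ p → ∀ u v → p u ≡ p v → SameType u v

  NeighbourhoodDiversity : ℕ → Set
  NeighbourhoodDiversity t = TypePartition t × (∀ s → TypePartition s → t ≤ s)

  -- colours {c₀, c₁, …, c_q} encoded as Maybe (Fin q): nothing = c₀, just i = c_{i+1}
  record SubsetSquareColouring (q : ℕ) : Set where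
    field
      col   : V → Maybe (Fin q)
      uniq  : ∀ v (i : Fin q) x y → inN[] v x ≡ true → inN[] v y ≡ true
              → col x ≡ just i → col y ≡ just i → x ≡ y
      few₀  : ∀ v → count (λ u → inN[] v u ∧ is-nothing (col u)) ≤ deg v

  -- χ_ssc(G) ≤ t  (χ_ssc is the least positive q admitting a q-subset square colouring)
  χssc≤ : ℕ → Set
  χssc≤ t = ∃[ q ] (1 ≤ q × q ≤ t × SubsetSquareColouring q)

{-# OPTIONS --safe #-}
module Submission where

-- Colour with the class of its type every vertex that is the chosen representative of its type
-- class or is isolated, and give all other vertices c₀. Representatives of distinct classes get
-- distinct colours, and an isolated vertex is alone in its closed neighbourhood, so no colour
-- repeats in any N[v]. A non-isolated uncoloured vertex v has a neighbour w, and the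
-- representative r of w's class is a twin of w different from v, hence also adjacent to v; so
-- every N[v] contains a coloured vertex, which keeps the number of c₀-vertices at most deg v.

open import Defs hiding (sym)
open import Data.Nat using (ℕ; zero; suc; _+_; _≤_; _<_; z≤n; s≤s; s≤s⁻¹; >-nonZero⁻¹)
open import Data.Nat.Properties using (≤-refl; m≤n⇒m≤1+n; +-suc)
open import Data.Fin using (Fin; zero; suc; _≟_; fromℕ<)
open import Data.Fin.Properties using (any?; nonZeroIndex)
open import Data.Bool using (Bool; true; false; _∨_; _∧_; if_then_else_)
open import Data.Bool.Properties using (∧-conicalˡ; ∧-zeroʳ; ∨-zeroʳ) renaming (_≟_ to _≟ᵇ_)
open import Data.Maybe using (Maybe; just; nothing; is-nothing)
open import Data.Maybe.Properties using (just-injective) renaming (≡-dec to ≡-dec-Maybe)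
open import Data.Product using (_×_; _,_; proj₂; ∃-syntax)
open import Data.Sum using (_⊎_; inj₁; inj₂)
open import Relation.Binary using (DecidableEquality)
open import Relation.Nullary using (¬_; Dec; yes; no; contradiction)
open import Relation.Nullary.Decidable using (⌊_⌋; ¬?; _⊎-dec_)
open import Relation.Binary.PropositionalEquality using (_≡_; _≢_; refl; sym; trans; cong; cong₂; subst; module ≡-Reasoning)

_⊆_ : ∀ {m} → (Fin m → Bool) → (Fin m → Bool) → Set
P ⊆ Q = ∀ u → P u ≡ true → Q u ≡ true

count-mono : ∀ {m} {P Q : Fin m → Bool} → P ⊆ Q → count P ≤ count Q
count-mono {zero} P⊆Q = z≤n
count-mono {suc m} {P} {Q} P⊆Q with P zero in P₀ | Q zero in Q₀
... | true  | true  = s≤s (count-mono (λ u → P⊆Q (suc u)))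
... | true  | false = contradiction (trans (sym (P⊆Q zero P₀)) Q₀) λ ()
... | false | true  = m≤n⇒m≤1+n (count-mono (λ u → P⊆Q (suc u)))
... | false | false = count-mono (λ u → P⊆Q (suc u))

count-< : ∀ {m} {P Q : Fin m → Bool} {b} → P ⊆ Q → Q b ≡ true → P b ≡ false → count P < count Q
count-< {suc m} {P} {Q} {zero} P⊆Q Qb Pb with P zero | Q zero
count-< P⊆Q refl refl | false | true = s≤s (count-mono (λ u → P⊆Q (suc u)))
count-< {suc m} {P} {Q} {suc b} P⊆Q Qb Pb with P zero in P₀ | Q zero in Q₀
... | true  | true  = s≤s (count-< (λ u → P⊆Q (suc u)) Qb Pb)
... | true  | false = contradiction (trans (sym (P⊆Q zero P₀)) Q₀) λ ()
... | false | true  = m≤n⇒m≤1+n (count-< (λ u → P⊆Q (suc u)) Qb Pb)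
... | false | false = count-< (λ u → P⊆Q (suc u)) Qb Pb

count-ext : ∀ {m} {P Q : Fin m → Bool} → (∀ u → P u ≡ Q u) → count P ≡ count Q
count-ext {zero}  P≡Q = refl
count-ext {suc m} P≡Q = cong₂ (λ h → (if h then 1 else 0) +_) (P≡Q zero) (count-ext (λ u → P≡Q (suc u)))

-- Not definitional: ⌊_⌋ matches on the Dec that _≟_ rebuilds with map′ at suc.
⌊suc≟suc⌋ : ∀ {m} (u a : Fin m) → ⌊ suc u ≟ suc a ⌋ ≡ ⌊ u ≟ a ⌋
⌊suc≟suc⌋ u a with u ≟ a
... | yes _ = refl
... | no _  = refl

count-insert : ∀ {m} {Q : Fin m → Bool} {a} → Q a ≡ false → count (λ u → ⌊ u ≟ a ⌋ ∨ Q u) ≡ suc (count Q)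
count-insert {suc m} {Q} {zero} Qa with Q zero
count-insert refl | false = refl
count-insert {suc m} {Q} {suc a} Qa = begin
  head + count (λ u → ⌊ suc u ≟ suc a ⌋ ∨ Q (suc u))
    ≡⟨ cong (head +_) (count-ext (λ u → cong (_∨ Q (suc u)) (⌊suc≟suc⌋ u a))) ⟩
  head + count (λ u → ⌊ u ≟ a ⌋ ∨ Q (suc u))
    ≡⟨ cong (head +_) (count-insert {Q = λ u → Q (suc u)} Qa) ⟩
  head + suc (count (λ u → Q (suc u)))
    ≡⟨ +-suc head _ ⟩
  suc (count Q) ∎
  where
    open ≡-Reasoning
    head = if Q zero then 1 else 0

module _ (G : Graph) where

  N[]-refl : ∀ v → inN[] G v v ≡ true
  N[]-refl v with v ≟ v
  ... | yes _ = refl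
  ... | no v≢v = contradiction refl v≢v

  N⊆N[] : ∀ {v u} → adj G v u ≡ true → inN[] G v u ≡ true
  N⊆N[] {v} {u} vu rewrite vu = ∨-zeroʳ ⌊ u ≟ v ⌋

  N[]-split : ∀ {v u} → inN[] G v u ≡ true → u ≡ v ⊎ adj G v u ≡ true
  N[]-split {v} {u} u∈N[v] with u ≟ v
  ... | yes u≡v = inj₁ u≡v
  ... | no _    = inj₂ u∈N[v]

  count-N[] : ∀ v → count (inN[] G v) ≡ suc (deg G v)
  count-N[] v = count-insert {Q = adj G v} (irrefl G v)

  twin-adj : ∀ {w r v} → SameType G w r → v ≢ r → adj G v w ≡ true → adj G v r ≡ true
  twin-adj {w} {r} {v} w~r v≢r vw =
    trans (Graph.sym G v r) (proj₂ (proj₂ (w~r v) (v≢r , trans (Graph.sym G w v) vw)))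

  few₀-of-coloured-in-N[] : ∀ {q} (col : V G → Maybe (Fin q)) v
    → ∃[ c ] ∃[ i ] inN[] G v c ≡ true × col c ≡ just i
    → count (λ u → inN[] G v u ∧ is-nothing (col u)) ≤ deg G v
  few₀-of-coloured-in-N[] col v (c , i , c∈N[v] , col-c) =
    s≤s⁻¹ (subst (count c₀-in-N[v] <_) (count-N[] v)
                 (count-< {Q = inN[] G v} (λ u → ∧-conicalˡ _ _) c∈N[v] c-not-c₀))
    where
      c₀-in-N[v] : V G → Bool
      c₀-in-N[v] u = inN[] G v u ∧ is-nothing (col u)

      c-not-c₀ : c₀-in-N[v] c ≡ false
      c-not-c₀ rewrite col-c = ∧-zeroʳ (inN[] G v c)

module Representative {m} {B : Set} (_≟B_ : DecidableEquality B) (f : Fin m → B) where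

  rep : B → Maybe (Fin m)
  rep b with any? (λ w → f w ≟B b)
  ... | yes (w , _) = just w
  ... | no _        = nothing

  rep-∈-fibre : ∀ {b w} → rep b ≡ just w → f w ≡ b
  rep-∈-fibre {b} eq with any? (λ w → f w ≟B b)
  rep-∈-fibre refl | yes (_ , fw≡b) = fw≡b

  rep-defined : ∀ {b} v → f v ≡ b → ∃[ w ] rep b ≡ just w
  rep-defined {b} v fv≡b with any? (λ w → f w ≟B b)
  ... | yes (w , _) = w , refl
  ... | no ∄        = contradiction (v , fv≡b) ∄

  IsRep : Fin m → Set
  IsRep v = rep (f v) ≡ just v

  isRep? : ∀ v → Dec (IsRep v)
  isRep? v = ≡-dec-Maybe _≟_ (rep (f v)) (just v)

  isRep-unique : ∀ {u v} → IsRep u → IsRep v → f u ≡ f v → u ≡ v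
  isRep-unique ru rv fu≡fv = just-injective (trans (sym ru) (trans (cong rep fu≡fv) rv))

  isRep-exists : ∀ v → ∃[ r ] IsRep r × f r ≡ f v
  isRep-exists v with rep-defined v refl
  ... | r , rep≡r = r , subst (λ b → rep b ≡ just r) (sym fr≡fv) rep≡r , fr≡fv
    where
      fr≡fv = rep-∈-fibre rep≡r

module TypeColouring (G : Graph) {t} (p : V G → Fin t) (p-type : ∀ u v → p u ≡ p v → SameType G u v) where

  open Representative _≟_ p

  Isolated : V G → Set
  Isolated v = ¬ (∃[ u ] adj G v u ≡ true)

  Coloured : V G → Set
  Coloured v = Isolated v ⊎ IsRep v

  coloured? : ∀ v → Dec (Coloured v)
  coloured? v = ¬? (any? λ u → adj G v u ≟ᵇ true) ⊎-dec isRep? v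

  colour : V G → Maybe (Fin t)
  colour v with coloured? v
  ... | yes _ = just (p v)
  ... | no _  = nothing

  colour-coloured : ∀ {v} → Coloured v → colour v ≡ just (p v)
  colour-coloured {v} cv with coloured? v
  ... | yes _  = refl
  ... | no ¬cv = contradiction cv ¬cv

  colour-just : ∀ {v i} → colour v ≡ just i → Coloured v × p v ≡ i
  colour-just {v} eq with coloured? v
  colour-just refl | yes cv = cv , refl

  isolated-N[] : ∀ {v x y} → Isolated x → inN[] G v x ≡ true → inN[] G v y ≡ true → x ≡ y
  isolated-N[] {v} {x} {y} iso x∈N[v] y∈N[v] with N[]-split G x∈N[v] | N[]-split G y∈N[v]
  ... | inj₂ vx    | _         = contradiction (v , trans (Graph.sym G x v) vx) iso
  ... | inj₁ refl  | inj₁ refl = refl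
  ... | inj₁ refl  | inj₂ xy   = contradiction (y , xy) iso

  colour-uniq : ∀ v (i : Fin t) x y → inN[] G v x ≡ true → inN[] G v y ≡ true
              → colour x ≡ just i → colour y ≡ just i → x ≡ y
  colour-uniq v i x y x∈N[v] y∈N[v] cx cy with colour-just cx | colour-just cy
  ... | inj₁ iso , _  | _            = isolated-N[] iso x∈N[v] y∈N[v]
  ... | _             | inj₁ iso , _ = sym (isolated-N[] iso y∈N[v] x∈N[v])
  ... | inj₂ rx , px  | inj₂ ry , py = isRep-unique rx ry (trans px (sym py))

  coloured-in-N[] : ∀ v → ∃[ c ] ∃[ i ] inN[] G v c ≡ true × colour c ≡ just i
  coloured-in-N[] v with any? (λ u → adj G v u ≟ᵇ true)
  ... | no ∄ = v , p v , N[]-refl G v , colour-coloured (inj₁ ∄)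
  ... | yes (w , vw) with isRep-exists w
  ...   | r , rr , pr≡pw with v ≟ r
  ...     | yes refl = v , p v , N[]-refl G v , colour-coloured (inj₂ rr)
  ...     | no v≢r   = r , p r , N⊆N[] G (twin-adj G (p-type w r (sym pr≡pw)) v≢r vw) , colour-coloured (inj₂ rr)

  colouring : SubsetSquareColouring G t
  colouring = record
    { col  = colour
    ; uniq = colour-uniq
    ; few₀ = λ v → few₀-of-coloured-in-N[] G colour v (coloured-in-N[] v)
    }

lemma11 : (G : Graph) (t : ℕ) → 1 ≤ n G → NeighbourhoodDiversity G t → χssc≤ G t
lemma11 G t n≥1 ((p , p-type) , _) =
  t , >-nonZero⁻¹ t {{nonZeroIndex (p (fromℕ< n≥1))}} , ≤-refl , TypeColouring.colouring G p p-type
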